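{- Let $f:\mathbb{F}_2[x]\setminus\{0\}\to\mathbb{F}_2[x]$ be a multiplicative function and let $f^{\mathrm{2conv}}=f*f$. For every nonzero $A\in\mathbb{F}_2[x]$, one has $f^{\mathrm{2conv}}(A)=A$ if and only if $A=S^2$ for some $S\in\mathbb{F}_2[x]$ with $f(S)=S$.
   Context: A map $f:\mathbb{F}_2[x]\setminus\{0\}\to\mathbb{F}_2[x]$ is multiplicative if $f(AB)=f(A)f(B)$ whenever $\gcd(A,B)=1$. The Dirichlet convolution of two such maps is $(f*g)(A)=\sum_{D\mid A} f(D)\,g(A/D)$, the sum running over all divisors $D\in\mathbb{F}_2[x]$ of $A$. -}

module Defs where

open import Data.Bool using (Bool; true; false; _xor_; if_then_else_)
open import Data.Nat using (ℕ; zero; suc)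
open import Data.List using (List; []; _∷_; foldr; concatMap; map; filter; cartesianProduct)
open import Data.Product using (_×_; _,_; ∃-syntax; uncurry)
open import Relation.Binary.PropositionalEquality using (_≡_; _≢_; refl; cong)
open import Relation.Nullary using (Dec; yes; no)
open import Relation.Nullary.Decidable using (map′)

-- A nonzero polynomial is built from its leading coefficient 1 by
-- repeatedly multiplying by x and adding a constant bit:
--   1⁺        = 1
--   p x+0     = p·x
--   p x+1     = p·x + 1
-- Every element of F₂[x] has exactly one representation, so
-- propositional equality _≡_ is equality of polynomials.

data Poly⁺ : Set where
  1⁺   : Poly⁺
  _x+0 : Poly⁺ → Poly⁺
  _x+1 : Poly⁺ → Poly⁺

data Poly : Set where
  0ₚ  : Poly
  [_] : Poly⁺ → Poly

1ₚ : Poly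
1ₚ = [ 1⁺ ]

shiftAdd : Poly → Bool → Poly
shiftAdd 0ₚ    false = 0ₚ
shiftAdd 0ₚ    true  = [ 1⁺ ]
shiftAdd [ p ] false = [ p x+0 ]
shiftAdd [ p ] true  = [ p x+1 ]

_+⁺_ : Poly⁺ → Poly⁺ → Poly
1⁺     +⁺ 1⁺     = 0ₚ
1⁺     +⁺ (q x+0) = [ q x+1 ]
1⁺     +⁺ (q x+1) = [ q x+0 ]
(p x+0) +⁺ 1⁺     = [ p x+1 ]
(p x+1) +⁺ 1⁺     = [ p x+0 ]
(p x+0) +⁺ (q x+0) = shiftAdd (p +⁺ q) false
(p x+0) +⁺ (q x+1) = shiftAdd (p +⁺ q) true
(p x+1) +⁺ (q x+0) = shiftAdd (p +⁺ q) true
(p x+1) +⁺ (q x+1) = shiftAdd (p +⁺ q) false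

infixl 6 _+_
infixl 7 _*_

_+_ : Poly → Poly → Poly
0ₚ    + q     = q
[ p ] + 0ₚ    = [ p ]
[ p ] + [ q ] = p +⁺ q

_*⁺_ : Poly⁺ → Poly → Poly
1⁺      *⁺ q = q
(p x+0) *⁺ q = shiftAdd (p *⁺ q) false
(p x+1) *⁺ q = shiftAdd (p *⁺ q) false + q

_*_ : Poly → Poly → Poly
0ₚ    * q = 0ₚ
[ p ] * q = p *⁺ q

_∣_ : Poly → Poly → Set
D ∣ A = ∃[ Q ] (Q * D ≡ A)

-- gcd(A,B) = 1 : every common divisor of A and B is (the only unit) 1.
Coprime : Poly → Poly → Set
Coprime A B = ∀ D → D ∣ A → D ∣ B → D ≡ 1ₚ

_≟⁺_ : (p q : Poly⁺) → Dec (p ≡ q)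
1⁺ ≟⁺ 1⁺ = yes refl
1⁺ ≟⁺ (q x+0) = no (λ ())
1⁺ ≟⁺ (q x+1) = no (λ ())
(p x+0) ≟⁺ 1⁺ = no (λ ())
(p x+0) ≟⁺ (q x+0) = map′ (cong _x+0) (λ { refl → refl }) (p ≟⁺ q)
(p x+0) ≟⁺ (q x+1) = no (λ ())
(p x+1) ≟⁺ 1⁺ = no (λ ())
(p x+1) ≟⁺ (q x+0) = no (λ ())
(p x+1) ≟⁺ (q x+1) = map′ (cong _x+1) (λ { refl → refl }) (p ≟⁺ q)

_≟_ : (p q : Poly) → Dec (p ≡ q)
0ₚ ≟ 0ₚ = yes refl
0ₚ ≟ [ q ] = no (λ ())
[ p ] ≟ 0ₚ = no (λ ())
[ p ] ≟ [ q ] = map′ (cong [_]) (λ { refl → refl }) (p ≟⁺ q)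

-- number of coefficients: 0 for the zero polynomial, deg + 1 otherwise
len⁺ : Poly⁺ → ℕ
len⁺ 1⁺ = 1
len⁺ (p x+0) = suc (len⁺ p)
len⁺ (p x+1) = suc (len⁺ p)

len : Poly → ℕ
len 0ₚ = 0
len [ p ] = len⁺ p

-- all polynomials of degree < n (each exactly once)
below : ℕ → List Poly
below zero    = 0ₚ ∷ []
below (suc n) = concatMap (λ p → shiftAdd p false ∷ shiftAdd p true ∷ []) (below n)

-- For A ≠ 0 every divisor D of A has
-- deg D ≤ deg A and a unique cofactor E = A / D (also of degree ≤ deg A),
-- so this list contains each pair (D , A/D), D ∣ A, exactly once.
divisorPairs : Poly → List (Poly × Poly)
divisorPairs A =
  filter (λ { (D , E) → (D * E) ≟ A }) (cartesianProduct (below (len A)) (below (len A)))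

sumP : List Poly → Poly
sumP = foldr _+_ 0ₚ

-- Arithmetic functions on F₂[x] ∖ {0}.  They are represented as total
-- functions Poly → Poly; the value at 0 is never used.

Multiplicative : (Poly → Poly) → Set
Multiplicative f =
  ∀ A B → A ≢ 0ₚ → B ≢ 0ₚ → Coprime A B → f (A * B) ≡ f A * f B

conv : (Poly → Poly) → (Poly → Poly) → Poly → Poly
conv f g A = sumP (map (λ { (D , E) → f D * g E }) (divisorPairs A))

-- In characteristic 2 the terms f(D) f(E) and f(E) f(D) of (f * f)(A) cancel
-- in pairs, so only the diagonal terms with D = E survive: (f * f)(A) is f(S)²
-- when A = S², and 0 when A is not a square.  Since squaring (the Frobenius
-- map) is injective, f(S)² = S² forces f(S) = S.
module Submission where

open import Defs
open import Algebra.Bundles using (CommutativeSemigroup)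
open import Data.Bool using (Bool; true; false; _xor_; if_then_else_)
open import Data.Bool.Properties using (xor-assoc; xor-comm; xor-same; not-¬)
open import Data.Empty using (⊥-elim)
open import Data.List using (List; []; _∷_; _++_; map; concatMap; filter; cartesianProduct)
open import Data.Nat using (zero; suc; z≤n; s≤s) renaming (_≤_ to _≤ℕ_)
open import Data.Nat.Properties using (m≤n⇒m≤1+n)
open import Data.Product using (_×_; _,_; ∃-syntax; ∃₂; proj₁; proj₂)
open import Function using (_∘_)
open import Function.Bundles using (_⇔_; mk⇔)
open import Level using (0ℓ)
open import Relation.Binary.PropositionalEquality
  using (_≡_; _≢_; refl; sym; trans; ≢-sym; cong; cong₂; subst; module ≡-Reasoning)
open import Relation.Binary.PropositionalEquality.Algebra using (isMagma)
open import Relation.Nullary using (Dec; yes; no; does; ¬_)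

open ≡-Reasoning

Poly-ind : (P : Poly → Set) → P 0ₚ → (∀ X b → P X → P (shiftAdd X b)) → ∀ X → P X
Poly-ind P P0 Pstep 0ₚ    = P0
Poly-ind P P0 Pstep [ p ] = go p
  where
  go : ∀ p → P [ p ]
  go 1⁺      = Pstep 0ₚ true P0
  go (p x+0) = Pstep [ p ] false (go p)
  go (p x+1) = Pstep [ p ] true (go p)

divX : Poly → Poly
divX 0ₚ        = 0ₚ
divX [ 1⁺ ]    = 0ₚ
divX [ p x+0 ] = [ p ]
divX [ p x+1 ] = [ p ]

coeff₀ : Poly → Bool
coeff₀ 0ₚ        = false
coeff₀ [ 1⁺ ]    = true
coeff₀ [ p x+0 ] = false
coeff₀ [ p x+1 ] = true

divX-shiftAdd : ∀ X b → divX (shiftAdd X b) ≡ X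
divX-shiftAdd 0ₚ    false = refl
divX-shiftAdd 0ₚ    true  = refl
divX-shiftAdd [ p ] false = refl
divX-shiftAdd [ p ] true  = refl

coeff₀-shiftAdd : ∀ X b → coeff₀ (shiftAdd X b) ≡ b
coeff₀-shiftAdd 0ₚ    false = refl
coeff₀-shiftAdd 0ₚ    true  = refl
coeff₀-shiftAdd [ p ] false = refl
coeff₀-shiftAdd [ p ] true  = refl

shiftAdd-surjective : ∀ X → ∃₂ λ Y b → shiftAdd Y b ≡ X
shiftAdd-surjective 0ₚ        = 0ₚ , false , refl
shiftAdd-surjective [ 1⁺ ]    = 0ₚ , true , refl
shiftAdd-surjective [ p x+0 ] = [ p ] , false , refl
shiftAdd-surjective [ p x+1 ] = [ p ] , true , refl

shiftAdd-injective : ∀ {X Y b c} → shiftAdd X b ≡ shiftAdd Y c → X ≡ Y × b ≡ c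
shiftAdd-injective {X} {Y} {b} {c} e =
  trans (sym (divX-shiftAdd X b)) (trans (cong divX e) (divX-shiftAdd Y c)) ,
  trans (sym (coeff₀-shiftAdd X b)) (trans (cong coeff₀ e) (coeff₀-shiftAdd Y c))

shiftAdd-false≢true : ∀ {X Y} → shiftAdd X false ≢ shiftAdd Y true
shiftAdd-false≢true = not-¬ refl ∘ proj₂ ∘ shiftAdd-injective

+-identityʳ : ∀ X → X + 0ₚ ≡ X
+-identityʳ 0ₚ    = refl
+-identityʳ [ p ] = refl

shiftAdd-+ : ∀ X Y b c → shiftAdd X b + shiftAdd Y c ≡ shiftAdd (X + Y) (b xor c)
shiftAdd-+ 0ₚ    0ₚ    false false = refl
shiftAdd-+ 0ₚ    0ₚ    false true  = refl
shiftAdd-+ 0ₚ    0ₚ    true  false = refl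
shiftAdd-+ 0ₚ    0ₚ    true  true  = refl
shiftAdd-+ 0ₚ    [ q ] false c     = refl
shiftAdd-+ 0ₚ    [ q ] true  false = refl
shiftAdd-+ 0ₚ    [ q ] true  true  = refl
shiftAdd-+ [ p ] 0ₚ    false false = refl
shiftAdd-+ [ p ] 0ₚ    false true  = refl
shiftAdd-+ [ p ] 0ₚ    true  false = refl
shiftAdd-+ [ p ] 0ₚ    true  true  = refl
shiftAdd-+ [ p ] [ q ] false false = refl
shiftAdd-+ [ p ] [ q ] false true  = refl
shiftAdd-+ [ p ] [ q ] true  false = refl
shiftAdd-+ [ p ] [ q ] true  true  = refl

+-assoc : ∀ X Y Z → (X + Y) + Z ≡ X + (Y + Z)
+-assoc = Poly-ind _ (λ _ _ → refl) step
  where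
  step : ∀ X b → (∀ Y Z → (X + Y) + Z ≡ X + (Y + Z)) →
         ∀ Y Z → (shiftAdd X b + Y) + Z ≡ shiftAdd X b + (Y + Z)
  step X b ih Y Z with shiftAdd-surjective Y | shiftAdd-surjective Z
  ... | Y′ , c , refl | Z′ , d , refl = begin
    (shiftAdd X b + shiftAdd Y′ c) + shiftAdd Z′ d   ≡⟨ cong (_+ shiftAdd Z′ d) (shiftAdd-+ X Y′ b c) ⟩
    shiftAdd (X + Y′) (b xor c) + shiftAdd Z′ d      ≡⟨ shiftAdd-+ (X + Y′) Z′ (b xor c) d ⟩
    shiftAdd ((X + Y′) + Z′) ((b xor c) xor d)       ≡⟨ cong₂ shiftAdd (ih Y′ Z′) (xor-assoc b c d) ⟩
    shiftAdd (X + (Y′ + Z′)) (b xor (c xor d))       ≡⟨ shiftAdd-+ X (Y′ + Z′) b (c xor d) ⟨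
    shiftAdd X b + shiftAdd (Y′ + Z′) (c xor d)      ≡⟨ cong (shiftAdd X b +_) (shiftAdd-+ Y′ Z′ c d) ⟨
    shiftAdd X b + (shiftAdd Y′ c + shiftAdd Z′ d)   ∎

+-comm : ∀ X Y → X + Y ≡ Y + X
+-comm = Poly-ind _ (λ Y → sym (+-identityʳ Y)) step
  where
  step : ∀ X b → (∀ Y → X + Y ≡ Y + X) → ∀ Y → shiftAdd X b + Y ≡ Y + shiftAdd X b
  step X b ih Y with shiftAdd-surjective Y
  ... | Y′ , c , refl = begin
    shiftAdd X b + shiftAdd Y′ c     ≡⟨ shiftAdd-+ X Y′ b c ⟩
    shiftAdd (X + Y′) (b xor c)      ≡⟨ cong₂ shiftAdd (ih Y′) (xor-comm b c) ⟩
    shiftAdd (Y′ + X) (c xor b)      ≡⟨ shiftAdd-+ Y′ X c b ⟨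
    shiftAdd Y′ c + shiftAdd X b     ∎

+-self : ∀ X → X + X ≡ 0ₚ
+-self = Poly-ind _ refl step
  where
  step : ∀ X b → X + X ≡ 0ₚ → shiftAdd X b + shiftAdd X b ≡ 0ₚ
  step X b ih = begin
    shiftAdd X b + shiftAdd X b   ≡⟨ shiftAdd-+ X X b b ⟩
    shiftAdd (X + X) (b xor b)    ≡⟨ cong₂ shiftAdd ih (xor-same b) ⟩
    shiftAdd 0ₚ false             ∎

+-commutativeSemigroup : CommutativeSemigroup 0ℓ 0ℓ
+-commutativeSemigroup = record
  { isCommutativeSemigroup = record
    { isSemigroup = record { isMagma = isMagma _+_ ; assoc = +-assoc }
    ; comm        = +-comm
    }
  }

open import Algebra.Properties.CommutativeSemigroup +-commutativeSemigroup
  using () renaming (interchange to +-interchange)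

*-zeroʳ : ∀ X → X * 0ₚ ≡ 0ₚ
*-zeroʳ 0ₚ        = refl
*-zeroʳ [ 1⁺ ]    = refl
*-zeroʳ [ p x+0 ] = cong (λ Z → shiftAdd Z false) (*-zeroʳ [ p ])
*-zeroʳ [ p x+1 ] = trans (+-identityʳ _) (cong (λ Z → shiftAdd Z false) (*-zeroʳ [ p ]))

*-identityʳ : ∀ X → X * 1ₚ ≡ X
*-identityʳ 0ₚ        = refl
*-identityʳ [ 1⁺ ]    = refl
*-identityʳ [ p x+0 ] = cong (λ Z → shiftAdd Z false) (*-identityʳ [ p ])
*-identityʳ [ p x+1 ] = cong (λ Z → shiftAdd Z false + 1ₚ) (*-identityʳ [ p ])

*-distribˡ-+ : ∀ X Y Z → X * (Y + Z) ≡ X * Y + X * Z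
*-distribˡ-+ 0ₚ        Y Z = refl
*-distribˡ-+ [ 1⁺ ]    Y Z = refl
*-distribˡ-+ [ p x+0 ] Y Z = begin
  shiftAdd ([ p ] * (Y + Z)) false                            ≡⟨ cong (λ W → shiftAdd W false) (*-distribˡ-+ [ p ] Y Z) ⟩
  shiftAdd ([ p ] * Y + [ p ] * Z) false                      ≡⟨ shiftAdd-+ ([ p ] * Y) ([ p ] * Z) false false ⟨
  shiftAdd ([ p ] * Y) false + shiftAdd ([ p ] * Z) false     ∎
*-distribˡ-+ [ p x+1 ] Y Z = begin
  shiftAdd ([ p ] * (Y + Z)) false + (Y + Z)          ≡⟨ cong (λ W → shiftAdd W false + (Y + Z)) (*-distribˡ-+ [ p ] Y Z) ⟩
  shiftAdd (pY + pZ) false + (Y + Z)                  ≡⟨ cong (_+ (Y + Z)) (shiftAdd-+ pY pZ false false) ⟨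
  (shiftAdd pY false + shiftAdd pZ false) + (Y + Z)   ≡⟨ +-interchange (shiftAdd pY false) (shiftAdd pZ false) Y Z ⟩
  (shiftAdd pY false + Y) + (shiftAdd pZ false + Z)   ∎
  where
  pY pZ : Poly
  pY = [ p ] * Y
  pZ = [ p ] * Z

*-shiftAdd-false : ∀ X Y → X * shiftAdd Y false ≡ shiftAdd (X * Y) false
*-shiftAdd-false 0ₚ        Y = refl
*-shiftAdd-false [ 1⁺ ]    Y = refl
*-shiftAdd-false [ p x+0 ] Y = cong (λ Z → shiftAdd Z false) (*-shiftAdd-false [ p ] Y)
*-shiftAdd-false [ p x+1 ] Y = begin
  shiftAdd ([ p ] * shiftAdd Y false) false + shiftAdd Y false  ≡⟨ cong (λ Z → shiftAdd Z false + shiftAdd Y false) (*-shiftAdd-false [ p ] Y) ⟩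
  shiftAdd (shiftAdd ([ p ] * Y) false) false + shiftAdd Y false ≡⟨ shiftAdd-+ (shiftAdd ([ p ] * Y) false) Y false false ⟩
  shiftAdd (shiftAdd ([ p ] * Y) false + Y) false               ∎

*-shiftAdd-true : ∀ X Y → X * shiftAdd Y true ≡ shiftAdd (X * Y) false + X
*-shiftAdd-true X Y = begin
  X * shiftAdd Y true                      ≡⟨ cong (X *_) shiftAdd-split ⟩
  X * (shiftAdd Y false + 1ₚ)              ≡⟨ *-distribˡ-+ X (shiftAdd Y false) 1ₚ ⟩
  X * shiftAdd Y false + X * 1ₚ            ≡⟨ cong₂ _+_ (*-shiftAdd-false X Y) (*-identityʳ X) ⟩
  shiftAdd (X * Y) false + X               ∎
  where
  shiftAdd-split : shiftAdd Y true ≡ shiftAdd Y false + 1ₚ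
  shiftAdd-split = begin
    shiftAdd Y true                   ≡⟨ cong (λ Z → shiftAdd Z true) (+-identityʳ Y) ⟨
    shiftAdd (Y + 0ₚ) true            ≡⟨ shiftAdd-+ Y 0ₚ false true ⟨
    shiftAdd Y false + shiftAdd 0ₚ true ∎

*-comm : ∀ X Y → X * Y ≡ Y * X
*-comm 0ₚ        Y = sym (*-zeroʳ Y)
*-comm [ 1⁺ ]    Y = sym (*-identityʳ Y)
*-comm [ p x+0 ] Y =
  trans (cong (λ Z → shiftAdd Z false) (*-comm [ p ] Y)) (sym (*-shiftAdd-false Y [ p ]))
*-comm [ p x+1 ] Y =
  trans (cong (λ Z → shiftAdd Z false + Y) (*-comm [ p ] Y)) (sym (*-shiftAdd-true Y [ p ]))

-- Squaring: (Σ aᵢ xⁱ)² = Σ aᵢ x²ⁱ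

sq⁺ : Poly⁺ → Poly⁺
sq⁺ 1⁺      = 1⁺
sq⁺ (p x+0) = (sq⁺ p x+0) x+0
sq⁺ (p x+1) = (sq⁺ p x+0) x+1

sq : Poly → Poly
sq 0ₚ    = 0ₚ
sq [ p ] = [ sq⁺ p ]

-- A left inverse of sq⁺, with junk values on non-squares.
sqrt⁺ : Poly⁺ → Poly⁺
sqrt⁺ ((p x+0) x+0) = sqrt⁺ p x+0
sqrt⁺ ((p x+0) x+1) = sqrt⁺ p x+1
sqrt⁺ _             = 1⁺

sqrt : Poly → Poly
sqrt 0ₚ    = 0ₚ
sqrt [ p ] = [ sqrt⁺ p ]

sqrt⁺-sq⁺ : ∀ p → sqrt⁺ (sq⁺ p) ≡ p
sqrt⁺-sq⁺ 1⁺      = refl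
sqrt⁺-sq⁺ (p x+0) = cong _x+0 (sqrt⁺-sq⁺ p)
sqrt⁺-sq⁺ (p x+1) = cong _x+1 (sqrt⁺-sq⁺ p)

sqrt-sq : ∀ X → sqrt (sq X) ≡ X
sqrt-sq 0ₚ    = refl
sqrt-sq [ p ] = cong [_] (sqrt⁺-sq⁺ p)

*-self≡sq : ∀ X → X * X ≡ sq X
*-self≡sq 0ₚ        = refl
*-self≡sq [ 1⁺ ]    = refl
*-self≡sq [ p x+0 ] = begin
  shiftAdd ([ p ] * [ p x+0 ]) false               ≡⟨ cong (λ Z → shiftAdd Z false) (*-shiftAdd-false [ p ] [ p ]) ⟩
  shiftAdd (shiftAdd ([ p ] * [ p ]) false) false  ≡⟨ cong (λ Z → shiftAdd (shiftAdd Z false) false) (*-self≡sq [ p ]) ⟩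
  [ (sq⁺ p x+0) x+0 ]                              ∎
*-self≡sq [ p x+1 ] = begin
  shiftAdd ([ p ] * [ p x+1 ]) false + [ p x+1 ]                   ≡⟨ cong (λ Z → shiftAdd Z false + [ p x+1 ]) (*-shiftAdd-true [ p ] [ p ]) ⟩
  shiftAdd (shiftAdd ([ p ] * [ p ]) false + [ p ]) false + [ p x+1 ] ≡⟨ cong (λ Z → shiftAdd (shiftAdd Z false + [ p ]) false + [ p x+1 ]) (*-self≡sq [ p ]) ⟩
  shiftAdd ([ sq⁺ p x+0 ] + [ p ]) false + shiftAdd [ p ] true      ≡⟨ shiftAdd-+ ([ sq⁺ p x+0 ] + [ p ]) [ p ] false true ⟩
  shiftAdd (([ sq⁺ p x+0 ] + [ p ]) + [ p ]) true                   ≡⟨ cong (λ Z → shiftAdd Z true) (+-assoc [ sq⁺ p x+0 ] [ p ] [ p ]) ⟩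
  shiftAdd ([ sq⁺ p x+0 ] + ([ p ] + [ p ])) true                   ≡⟨ cong (λ Z → shiftAdd ([ sq⁺ p x+0 ] + Z) true) (+-self [ p ]) ⟩
  [ (sq⁺ p x+0) x+1 ]                                               ∎

*-self-injective : ∀ {X Y} → X * X ≡ Y * Y → X ≡ Y
*-self-injective {X} {Y} e = begin
  X                 ≡⟨ sqrt-sq X ⟨
  sqrt (sq X)       ≡⟨ cong sqrt (trans (sym (*-self≡sq X)) (trans e (*-self≡sq Y))) ⟩
  sqrt (sq Y)       ≡⟨ sqrt-sq Y ⟩
  Y                 ∎

isSquare? : ∀ A → Dec (∃[ S ] S * S ≡ A)
isSquare? A with sq (sqrt A) ≟ A
... | yes e = yes (sqrt A , trans (*-self≡sq (sqrt A)) e)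
... | no ¬e = no λ { (S , refl) → ¬e (begin
  sq (sqrt (S * S))   ≡⟨ cong (sq ∘ sqrt) (*-self≡sq S) ⟩
  sq (sqrt (sq S))    ≡⟨ cong sq (sqrt-sq S) ⟩
  sq S                ≡⟨ *-self≡sq S ⟨
  S * S               ∎) }

len-sq : ∀ X → len X ≤ℕ len (sq X)
len-sq 0ₚ    = z≤n
len-sq [ p ] = go p
  where
  go : ∀ p → len⁺ p ≤ℕ len⁺ (sq⁺ p)
  go 1⁺      = s≤s z≤n
  go (p x+0) = s≤s (m≤n⇒m≤1+n (go p))
  go (p x+1) = s≤s (m≤n⇒m≤1+n (go p))

∑ : {I : Set} → List I → (I → Poly) → Poly
∑ xs g = sumP (map g xs)

module _ {I : Set} where

  ∑-++ : (g : I → Poly) (xs ys : List I) → ∑ (xs ++ ys) g ≡ ∑ xs g + ∑ ys g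
  ∑-++ g []       ys = refl
  ∑-++ g (x ∷ xs) ys = trans (cong (g x +_) (∑-++ g xs ys)) (sym (+-assoc (g x) (∑ xs g) (∑ ys g)))

  ∑-cong : {g h : I → Poly} → (∀ x → g x ≡ h x) → (xs : List I) → ∑ xs g ≡ ∑ xs h
  ∑-cong g≗h []       = refl
  ∑-cong g≗h (x ∷ xs) = cong₂ _+_ (g≗h x) (∑-cong g≗h xs)

  ∑-zero : {g : I → Poly} → (∀ x → g x ≡ 0ₚ) → (xs : List I) → ∑ xs g ≡ 0ₚ
  ∑-zero g≗0 []       = refl
  ∑-zero g≗0 (x ∷ xs) = cong₂ _+_ (g≗0 x) (∑-zero g≗0 xs)

  ∑-+ : (g h : I → Poly) (xs : List I) → ∑ xs (λ x → g x + h x) ≡ ∑ xs g + ∑ xs h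
  ∑-+ g h []       = refl
  ∑-+ g h (x ∷ xs) = trans (cong ((g x + h x) +_) (∑-+ g h xs)) (+-interchange (g x) (h x) (∑ xs g) (∑ xs h))

  ∑-filter : {P : I → Set} (P? : ∀ x → Dec (P x)) (g : I → Poly) (xs : List I) →
             ∑ (filter P? xs) g ≡ ∑ xs (λ x → if does (P? x) then g x else 0ₚ)
  ∑-filter P? g []       = refl
  ∑-filter P? g (x ∷ xs) with does (P? x)
  ... | true  = cong (g x +_) (∑-filter P? g xs)
  ... | false = ∑-filter P? g xs

  ∑-map : {J : Set} (k : J → I) (g : I → Poly) (xs : List J) → ∑ (map k xs) g ≡ ∑ xs (g ∘ k)
  ∑-map k g []       = refl
  ∑-map k g (x ∷ xs) = cong (g (k x) +_) (∑-map k g xs)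

  ∑-concatMap : {J : Set} (k : J → List I) (g : I → Poly) (xs : List J) →
                ∑ (concatMap k xs) g ≡ ∑ xs (λ x → ∑ (k x) g)
  ∑-concatMap k g []       = refl
  ∑-concatMap k g (x ∷ xs) = trans (∑-++ g (k x) (concatMap k xs)) (cong (∑ (k x) g +_) (∑-concatMap k g xs))

  -- Characteristic 2: the off-diagonal terms F x y and F y x cancel.
  ∑∑-symmetric : (F : I → I → Poly) → (∀ x y → F x y ≡ F y x) → (xs : List I) →
                 ∑ xs (λ x → ∑ xs (F x)) ≡ ∑ xs (λ x → F x x)
  ∑∑-symmetric F F-sym []       = refl
  ∑∑-symmetric F F-sym (x ∷ xs) = begin
    (F x x + R) + ∑ xs (λ y → F y x + ∑ xs (F y))  ≡⟨ cong ((F x x + R) +_) (∑-+ (λ y → F y x) (λ y → ∑ xs (F y)) xs) ⟩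
    (F x x + R) + (∑ xs (λ y → F y x) + T)         ≡⟨ cong (λ Z → (F x x + R) + (Z + T)) (∑-cong (λ y → F-sym y x) xs) ⟩
    (F x x + R) + (R + T)                           ≡⟨ +-assoc (F x x) R (R + T) ⟩
    F x x + (R + (R + T))                           ≡⟨ cong (F x x +_) (+-assoc R R T) ⟨
    F x x + ((R + R) + T)                           ≡⟨ cong (λ Z → F x x + (Z + T)) (+-self R) ⟩
    F x x + T                                       ≡⟨ cong (F x x +_) (∑∑-symmetric F F-sym xs) ⟩
    F x x + ∑ xs (λ y → F y y)                      ∎
    where
    R T : Poly
    R = ∑ xs (F x)
    T = ∑ xs (λ y → ∑ xs (F y))

∑-cartesianProduct : {I J : Set} (g : I × J → Poly) (xs : List I) (ys : List J) →
                     ∑ (cartesianProduct xs ys) g ≡ ∑ xs (λ x → ∑ ys (λ y → g (x , y)))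
∑-cartesianProduct g []       ys = refl
∑-cartesianProduct g (x ∷ xs) ys =
  trans (∑-++ g (map (x ,_) ys) (cartesianProduct xs ys))
        (cong₂ _+_ (∑-map (x ,_) g ys) (∑-cartesianProduct g xs ys))

indicator : Poly → Poly → Poly → Poly
indicator S c D = if does (D ≟ S) then c else 0ₚ

indicator-refl : ∀ S c → indicator S c S ≡ c
indicator-refl S c with S ≟ S
... | yes _   = refl
... | no S≢S = ⊥-elim (S≢S refl)

indicator-≢ : ∀ {S D} c → D ≢ S → indicator S c D ≡ 0ₚ
indicator-≢ {S} {D} c D≢S with D ≟ S
... | yes D≡S = ⊥-elim (D≢S D≡S)
... | no _    = refl

indicator-shiftAdd : ∀ S b c D →
  indicator (shiftAdd S b) c (shiftAdd D false) + indicator (shiftAdd S b) c (shiftAdd D true) ≡ indicator S c D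
indicator-shiftAdd S b c D with D ≟ S
... | no D≢S = begin
  indicator (shiftAdd S b) c (shiftAdd D false) + indicator (shiftAdd S b) c (shiftAdd D true)
    ≡⟨ cong₂ _+_ (indicator-≢ c (D≢S ∘ proj₁ ∘ shiftAdd-injective))
                 (indicator-≢ c (D≢S ∘ proj₁ ∘ shiftAdd-injective)) ⟩
  0ₚ ∎
indicator-shiftAdd S false c D | yes refl = begin
  indicator (shiftAdd S false) c (shiftAdd S false) + indicator (shiftAdd S false) c (shiftAdd S true)
    ≡⟨ cong₂ _+_ (indicator-refl (shiftAdd S false) c) (indicator-≢ c (≢-sym (shiftAdd-false≢true {S} {S}))) ⟩
  c + 0ₚ ≡⟨ +-identityʳ c ⟩
  c ∎
indicator-shiftAdd S true c D | yes refl = begin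
  indicator (shiftAdd S true) c (shiftAdd S false) + indicator (shiftAdd S true) c (shiftAdd S true)
    ≡⟨ cong₂ _+_ (indicator-≢ c (shiftAdd-false≢true {S} {S})) (indicator-refl (shiftAdd S true) c) ⟩
  c ∎

len-shiftAdd-≤ : ∀ {X b n} → len (shiftAdd X b) ≤ℕ suc n → len X ≤ℕ n
len-shiftAdd-≤ {0ₚ}            _        = z≤n
len-shiftAdd-≤ {[ p ]} {false} (s≤s le) = le
len-shiftAdd-≤ {[ p ]} {true}  (s≤s le) = le

∑-below-indicator : ∀ n S c → len S ≤ℕ n → ∑ (below n) (indicator S c) ≡ c
∑-below-indicator zero    0ₚ        c _  = +-identityʳ c
∑-below-indicator zero    [ 1⁺ ]    c ()
∑-below-indicator zero    [ _ x+0 ] c ()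
∑-below-indicator zero    [ _ x+1 ] c ()
∑-below-indicator (suc n) S         c le with shiftAdd-surjective S
... | S′ , b , refl = begin
  ∑ (below (suc n)) (indicator (shiftAdd S′ b) c)
    ≡⟨ ∑-concatMap (λ D → shiftAdd D false ∷ shiftAdd D true ∷ []) (indicator (shiftAdd S′ b) c) (below n) ⟩
  ∑ (below n) (λ D → indicator (shiftAdd S′ b) c (shiftAdd D false) + (indicator (shiftAdd S′ b) c (shiftAdd D true) + 0ₚ))
    ≡⟨ ∑-cong (λ D → trans (cong (indicator (shiftAdd S′ b) c (shiftAdd D false) +_) (+-identityʳ _)) (indicator-shiftAdd S′ b c D)) (below n) ⟩
  ∑ (below n) (indicator S′ c)
    ≡⟨ ∑-below-indicator n S′ c (len-shiftAdd-≤ {S′} {b} le) ⟩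
  c ∎

conv-self≡∑-diagonal : ∀ f A → conv f f A ≡ ∑ (below (len A)) (λ D → indicator A (f D * f D) (D * D))
conv-self≡∑-diagonal f A = begin
  conv f f A
    ≡⟨ ∑-filter _ _ (cartesianProduct (below (len A)) (below (len A))) ⟩
  ∑ (cartesianProduct (below (len A)) (below (len A))) _
    ≡⟨ ∑-cartesianProduct _ (below (len A)) (below (len A)) ⟩
  ∑ (below (len A)) (λ D → ∑ (below (len A)) (F D))
    ≡⟨ ∑∑-symmetric F F-sym (below (len A)) ⟩
  ∑ (below (len A)) (λ D → indicator A (f D * f D) (D * D)) ∎
  where
  F : Poly → Poly → Poly
  F D E = indicator A (f D * f E) (D * E)
  F-sym : ∀ D E → F D E ≡ F E D
  F-sym D E = cong₂ (indicator A) (*-comm (f D) (f E)) (*-comm D E)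

conv-self-square : ∀ f S → conv f f (S * S) ≡ f S * f S
conv-self-square f S = begin
  conv f f (S * S)
    ≡⟨ conv-self≡∑-diagonal f (S * S) ⟩
  ∑ (below (len (S * S))) (λ D → indicator (S * S) (f D * f D) (D * D))
    ≡⟨ ∑-cong diagonal-term (below (len (S * S))) ⟩
  ∑ (below (len (S * S))) (indicator S (f S * f S))
    ≡⟨ ∑-below-indicator (len (S * S)) S (f S * f S) len-S≤len-S*S ⟩
  f S * f S ∎
  where
  diagonal-term : ∀ D → indicator (S * S) (f D * f D) (D * D) ≡ indicator S (f S * f S) D
  diagonal-term D with D ≟ S
  ... | yes refl = indicator-refl (D * D) (f D * f D)
  ... | no D≢S   = indicator-≢ (f D * f D) (D≢S ∘ *-self-injective)
  len-S≤len-S*S : len S ≤ℕ len (S * S)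
  len-S≤len-S*S = subst (len S ≤ℕ_) (cong len (sym (*-self≡sq S))) (len-sq S)

conv-self-nonsquare : ∀ f A → ¬ (∃[ S ] S * S ≡ A) → conv f f A ≡ 0ₚ
conv-self-nonsquare f A A-nonsquare =
  trans (conv-self≡∑-diagonal f A)
        (∑-zero (λ D → indicator-≢ (f D * f D) (λ D*D≡A → A-nonsquare (D , D*D≡A))) (below (len A)))

corollary3p8 : (f : Poly → Poly) → Multiplicative f →
    (A : Poly) → A ≢ 0ₚ →
    (conv f f A ≡ A) ⇔ (∃[ S ] (A ≡ S * S × f S ≡ S))
corollary3p8 f _ A A≢0 = mk⇔ to from
  where
  to : conv f f A ≡ A → ∃[ S ] (A ≡ S * S × f S ≡ S)
  to ff[A]≡A with isSquare? A
  ... | no A-nonsquare = ⊥-elim (A≢0 (trans (sym ff[A]≡A) (conv-self-nonsquare f A A-nonsquare)))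
  ... | yes (S , refl) = S , refl , *-self-injective (trans (sym (conv-self-square f S)) ff[A]≡A)
  from : ∃[ S ] (A ≡ S * S × f S ≡ S) → conv f f A ≡ A
  from (S , refl , fS≡S) = trans (conv-self-square f S) (cong (λ T → T * T) fS≡S)
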